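{- Let $G$ be a graph with a consistent 2-join $(X_1,X_2)$, and let $G_1,G_2$ be the blocks of decomposition of $G$ with respect to this 2-join. Then $G$ has no clique cutset if and only if neither $G_1$ nor $G_2$ has a clique cutset.
   Context: An almost 2-join of $G$ is a partition $(X_1,X_2)$ of $V(G)$ such that for $i=1,2$, $X_i$ contains disjoint nonempty sets $A_i,B_i$, every node of $A_1$ is adjacent to every node of $A_2$, every node of $B_1$ is adjacent to every node of $B_2$, there are no other edges between $X_1$ and $X_2$, and $|X_i|\ge3$. It is a 2-join if moreover, for $i=1,2$, $G[X_i]$ contains a path from $A_i$ to $B_i$, and if $|A_i|=|B_i|=1$ then $G[X_i]$ is not a chordless path. It is consistent if for $i=1,2$: (1) every component of $G[X_i]$ meets both $A_i$ and $B_i$; (2) every node of $A_i$ has a non-neighbor in $B_i$; (3) every node of $B_i$ has a non-neighbor in $A_i$; (4) either $A_1,A_2$ are both cliques, or one of them is a single node and the other is a disjoint union of cliques; (5) the same for $B_1,B_2$; (6) $G[X_i]$ is connected; (7) every node $v\in X_i$ has a path to some node of $B_i$ with no internal node in $A_i$; (8) every node $v\in X_i$ has a path to some node of $A_i$ with no internal node in $B_i$. Blocks of decomposition: $G_1$ is obtained from $G$ by deleting $X_2$ and adding a path $a_2c_2b_2$ where $a_2$ is adjacent exactly to $c_2$ and all of $A_1$, $b_2$ is adjacent exactly to $c_2$ and all of $B_1$, and $c_2$ is adjacent only to $a_2,b_2$; $G_2$ is obtained symmetrically by replacing $X_1$ by a path $a_1c_1b_1$ with $a_1$ complete to $A_2$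 and $b_1$ complete to $B_2$. A clique cutset is a set of nodes inducing a clique (possibly empty) whose removal disconnects the graph. -}

module Defs where

open import Data.Bool using (Bool; true; false; _∧_; _∨_; not)
open import Data.Nat using (ℕ; suc)
open import Data.Fin using (Fin; toℕ)
open import Data.Product using (Σ; ∃; ∃-syntax; _×_; _,_)
open import Data.Sum using (_⊎_; inj₁; inj₂)
open import Relation.Nullary using (¬_)
open import Data.Empty using (⊥)
open import Relation.Binary.PropositionalEquality using (_≡_; _≢_; refl; sym)
open import Function.Bundles using (_⇔_)

record Graph (V : Set) : Set where
  field
    adj    : V → V → Bool
    adj-sym   : ∀ u v → adj u v ≡ adj v u
    adj-irrefl : ∀ v → adj v v ≡ false

open Graph public

Edge : {V : Set} → Graph V → V → V → Set
Edge G u v = adj G u v ≡ true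

Subset : Set → Set
Subset V = V → Bool

_∈_ : {V : Set} → V → Subset V → Set
v ∈ S = S v ≡ true

_∉_ : {V : Set} → V → Subset V → Set
v ∉ S = S v ≡ false

-- Walks all of whose vertices lie in S, i.e. walks in the induced subgraph G[S].
-- (A walk between two vertices exists iff a path does.)
data WalkIn {V : Set} (G : Graph V) (S : Subset V) : V → V → Set where
  here : ∀ {u} → u ∈ S → WalkIn G S u u
  step : ∀ {u w v} → u ∈ S → Edge G u w → WalkIn G S w v → WalkIn G S u v

_∖_ : {V : Set} → Subset V → Subset V → Subset V
(S ∖ T) v = S v ∧ not (T v)

-- There is a path from u to v in G[S] with no internal node in T.
PathAvoidingInterior : {V : Set} → Graph V → Subset V → Subset V → V → V → Set
PathAvoidingInterior G S T u v =
  u ∈ S × v ∈ S ×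
  (u ≡ v ⊎ Edge G u v ⊎
   (∃[ w ] ∃[ w' ] (Edge G u w × WalkIn G (S ∖ T) w w' × Edge G w' v)))

ConnectedIn : {V : Set} → Graph V → Subset V → Set
ConnectedIn G S = ∀ u v → u ∈ S → v ∈ S → WalkIn G S u v

IsClique : {V : Set} → Graph V → Subset V → Set
IsClique G S = ∀ u v → u ∈ S → v ∈ S → u ≢ v → Edge G u v

IsDisjointUnionOfCliques : {V : Set} → Graph V → Subset V → Set
IsDisjointUnionOfCliques G S = ∀ u v → WalkIn G S u v → u ≢ v → Edge G u v

IsSingleton : {V : Set} → Subset V → Set
IsSingleton S = ∃[ a ] (a ∈ S × (∀ v → v ∈ S → v ≡ a))

Nonempty : {V : Set} → Subset V → Set
Nonempty S = ∃[ v ] (v ∈ S)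

AtLeast3 : {V : Set} → Subset V → Set
AtLeast3 S = ∃[ x ] ∃[ y ] ∃[ z ]
  (x ∈ S × y ∈ S × z ∈ S × x ≢ y × x ≢ z × y ≢ z)

IsChordlessPath : {V : Set} → Graph V → Subset V → Set
IsChordlessPath {V} G S = ∃[ k ] Σ (Fin k → V) λ f →
  (∀ i j → f i ≡ f j → i ≡ j) ×
  (∀ i → f i ∈ S) ×
  (∀ v → v ∈ S → ∃[ i ] (f i ≡ v)) ×
  (∀ i j → Edge G (f i) (f j) ⇔ (toℕ j ≡ suc (toℕ i) ⊎ toℕ i ≡ suc (toℕ j)))

-- Clique cutset: a (possibly empty) clique K whose removal disconnects G,
-- i.e. there are two nodes outside K joined by no path in G ∖ K.
IsCliqueCutset : {V : Set} → Graph V → Subset V → Set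
IsCliqueCutset {V} G K = IsClique G K ×
  (∃[ u ] ∃[ v ] (u ∉ K × v ∉ K × ¬ WalkIn G (λ x → not (K x)) u v))

HasCliqueCutset : {V : Set} → Graph V → Set
HasCliqueCutset {V} G = ∃[ K ] IsCliqueCutset G K

-- 2-joins.  Sides are indexed by Bool: side true = X₁, side false = X₂.

record TwoJoinData {V : Set} (G : Graph V) : Set where
  field
    side : V → Bool
    A B  : Bool → Subset V

  X : Bool → Subset V
  X true  v = side v
  X false v = not (side v)

open TwoJoinData public

module _ {V : Set} {G : Graph V} (J : TwoJoinData G) where

  IsAlmost2Join : Set
  IsAlmost2Join =
    (∀ i v → v ∈ A J i → v ∈ X J i) ×
    (∀ i v → v ∈ B J i → v ∈ X J i) ×
    (∀ i v → v ∈ A J i → v ∈ B J i → ⊥) ×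
    (∀ i → Nonempty (A J i)) ×
    (∀ i → Nonempty (B J i)) ×
    (∀ u v → u ∈ A J true → v ∈ A J false → Edge G u v) ×
    (∀ u v → u ∈ B J true → v ∈ B J false → Edge G u v) ×
    (∀ u v → u ∈ X J true → v ∈ X J false → Edge G u v →
       (u ∈ A J true × v ∈ A J false) ⊎ (u ∈ B J true × v ∈ B J false)) ×
    (∀ i → AtLeast3 (X J i))

  Is2Join : Set
  Is2Join = IsAlmost2Join ×
    (∀ i → ∃[ a ] ∃[ b ] (a ∈ A J i × b ∈ B J i × WalkIn G (X J i) a b)) ×
    (∀ i → IsSingleton (A J i) → IsSingleton (B J i) → ¬ IsChordlessPath G (X J i))

  CliqueCondition : (Bool → Subset V) → Set
  CliqueCondition S =
    (IsClique G (S true) × IsClique G (S false)) ⊎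
    (IsSingleton (S true) × IsDisjointUnionOfCliques G (S false)) ⊎
    (IsSingleton (S false) × IsDisjointUnionOfCliques G (S true))

  IsConsistent : Set
  IsConsistent = IsAlmost2Join ×
    (∀ i v → v ∈ X J i →
       (∃[ a ] (a ∈ A J i × WalkIn G (X J i) v a)) ×
       (∃[ b ] (b ∈ B J i × WalkIn G (X J i) v b))) ×
    (∀ i a → a ∈ A J i → ∃[ b ] (b ∈ B J i × ¬ Edge G a b)) ×
    (∀ i b → b ∈ B J i → ∃[ a ] (a ∈ A J i × ¬ Edge G b a)) ×
    -- (4), (5)
    CliqueCondition (A J) ×
    CliqueCondition (B J) ×
    -- (6)
    (∀ i → ConnectedIn G (X J i)) ×
    -- (7), (8)
    (∀ i v → v ∈ X J i →
       ∃[ b ] (b ∈ B J i × PathAvoidingInterior G (X J i) (A J i) v b)) ×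
    (∀ i v → v ∈ X J i →
       ∃[ a ] (a ∈ A J i × PathAvoidingInterior G (X J i) (B J i) v a))

-- Blocks of decomposition.  Block i keeps Xᵢ and replaces the other side
-- by a path a c b, with a complete to Aᵢ and b complete to Bᵢ.

data Extra : Set where
  ea ec eb : Extra

module _ {V : Set} {G : Graph V} (J : TwoJoinData G) (i : Bool) where

  BlockV : Set
  BlockV = Σ V (λ v → v ∈ X J i) ⊎ Extra

  blockAdj : BlockV → BlockV → Bool
  blockAdj (inj₁ (u , _)) (inj₁ (v , _)) = adj G u v
  blockAdj (inj₁ (u , _)) (inj₂ ea) = A J i u
  blockAdj (inj₁ (u , _)) (inj₂ eb) = B J i u
  blockAdj (inj₁ (u , _)) (inj₂ ec) = false
  blockAdj (inj₂ ea) (inj₁ (u , _)) = A J i u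
  blockAdj (inj₂ eb) (inj₁ (u , _)) = B J i u
  blockAdj (inj₂ ec) (inj₁ (u , _)) = false
  blockAdj (inj₂ ea) (inj₂ ec) = true
  blockAdj (inj₂ ec) (inj₂ ea) = true
  blockAdj (inj₂ eb) (inj₂ ec) = true
  blockAdj (inj₂ ec) (inj₂ eb) = true
  blockAdj (inj₂ _) (inj₂ _) = false

  blockAdj-sym : ∀ u v → blockAdj u v ≡ blockAdj v u
  blockAdj-sym (inj₁ (u , _)) (inj₁ (v , _)) = adj-sym G u v
  blockAdj-sym (inj₁ _) (inj₂ ea) = refl
  blockAdj-sym (inj₁ _) (inj₂ ec) = refl
  blockAdj-sym (inj₁ _) (inj₂ eb) = refl
  blockAdj-sym (inj₂ ea) (inj₁ _) = refl
  blockAdj-sym (inj₂ ec) (inj₁ _) = refl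
  blockAdj-sym (inj₂ eb) (inj₁ _) = refl
  blockAdj-sym (inj₂ ea) (inj₂ ea) = refl
  blockAdj-sym (inj₂ ea) (inj₂ ec) = refl
  blockAdj-sym (inj₂ ea) (inj₂ eb) = refl
  blockAdj-sym (inj₂ ec) (inj₂ ea) = refl
  blockAdj-sym (inj₂ ec) (inj₂ ec) = refl
  blockAdj-sym (inj₂ ec) (inj₂ eb) = refl
  blockAdj-sym (inj₂ eb) (inj₂ ea) = refl
  blockAdj-sym (inj₂ eb) (inj₂ ec) = refl
  blockAdj-sym (inj₂ eb) (inj₂ eb) = refl

  blockAdj-irrefl : ∀ v → blockAdj v v ≡ false
  blockAdj-irrefl (inj₁ (v , _)) = adj-irrefl G v
  blockAdj-irrefl (inj₂ ea) = refl
  blockAdj-irrefl (inj₂ ec) = refl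
  blockAdj-irrefl (inj₂ eb) = refl

  Block : Graph BlockV
  Block = record { adj = blockAdj ; adj-sym = blockAdj-sym ; adj-irrefl = blockAdj-irrefl }

-- Let Gᵢ be the block keeping Xᵢ, with marker path a – c – b.  A clique cutset K of G either
-- misses the side X_{¬i}, and then K itself is a clique cutset of Gᵢ, or it has an edge across
-- the 2-join and therefore lies in A₁ ∪ A₂ or in B₁ ∪ B₂; then (K ∩ X₁) ∪ {a} (resp. ∪ {b}) is
-- a clique cutset of G₁.  Conversely, a clique cutset K of Gᵢ that contains c or misses Xᵢ
-- cannot disconnect Gᵢ, as Xᵢ is connected; otherwise K contains at most one of a, b, and
-- K ∩ Xᵢ is a clique cutset of G, enlarged by A_{¬i} if a ∈ K and A_{¬i} is a clique (resp. B);
-- by condition (4) the alternative is that Aᵢ is a single vertex, which then lies in K.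
-- In each case a path of one graph joining the two shores is turned into one of the other by
-- replacing its excursion into the other side, or along a c b, by a passage through matching
-- ports, conditions (6)–(8) providing the way back.
-- All conclusions are negative, so excluded middle is available under double negation.

module Submission where

open import Defs
open import Axiom.UniquenessOfIdentityProofs.WithK using (uip)
open import Data.Bool using (Bool; true; false; _∧_; _∨_; not; _≟_)
open import Data.Bool.Properties using (not-involutive; not-injective; not-¬; ¬-not)
open import Data.Empty using (⊥; ⊥-elim)
open import Data.Fin using (Fin)
open import Data.Nat using (ℕ)
open import Data.Product using (Σ; ∃; ∃-syntax; _×_; _,_; proj₁; proj₂)
open import Data.Sum using (_⊎_; inj₁; inj₂)
open import Function using (_∘_)
open import Function.Bundles using (_⇔_; mk⇔)
open import Relation.Nullary using (¬_; yes; no)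
open import Relation.Nullary.Decidable using (¬¬-excluded-middle)
open import Relation.Binary.PropositionalEquality using (_≡_; _≢_; refl; sym; trans; cong; subst)

-- Membership x ∈ S is S x ≡ true; these are stated for the Boolean S x so that S and x never
-- have to be inferred.

∈∁⇒∉ : ∀ {b} → not b ≡ true → b ≡ false
∈∁⇒∉ = not-injective

∉⇒∈∁ : ∀ {b} → b ≡ false → not b ≡ true
∉⇒∈∁ = cong not

∈-or-∉ : (b : Bool) → b ≡ true ⊎ b ≡ false
∈-or-∉ true  = inj₁ refl
∈-or-∉ false = inj₂ refl

module _ {V : Set} where

  infixr 30 _∪_ _∩_
  infix 4 _⊆_

  ∁ : Subset V → Subset V
  ∁ S x = not (S x)

  _∪_ : Subset V → Subset V → Subset V
  (S ∪ T) x = S x ∨ T x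

  _∩_ : Subset V → Subset V → Subset V
  (S ∩ T) x = S x ∧ T x

  ∅ : Subset V
  ∅ _ = false

  _⊆_ : Subset V → Subset V → Set
  S ⊆ T = ∀ x → x ∈ S → x ∈ T

  ∈-∪⁻ : ∀ S T {x} → x ∈ S ∪ T → x ∈ S ⊎ x ∈ T
  ∈-∪⁻ S T {x} h with S x
  ... | true  = inj₁ refl
  ... | false = inj₂ h

  ∉-∪⁺ : ∀ S T {x} → x ∉ S → x ∉ T → x ∉ S ∪ T
  ∉-∪⁺ S T x∉S x∉T rewrite x∉S = x∉T

  ∉-∪⁻ˡ : ∀ S T {x} → x ∉ S ∪ T → x ∉ S
  ∉-∪⁻ˡ S T {x} h with S x
  ... | false = refl

  ∉-∪⁻ʳ : ∀ S T {x} → x ∉ S ∪ T → x ∉ T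
  ∉-∪⁻ʳ S T {x} h with S x
  ... | false = h

  ∈-∩⁺ : ∀ S T {x} → x ∈ S → x ∈ T → x ∈ S ∩ T
  ∈-∩⁺ S T x∈S x∈T rewrite x∈S = x∈T

  ∈-∩⁻ : ∀ S T {x} → x ∈ S ∩ T → x ∈ S × x ∈ T
  ∈-∩⁻ S T {x} h with S x
  ... | true = refl , h

edge-sym : ∀ {V : Set} (G : Graph V) {u v} → Edge G u v → Edge G v u
edge-sym G {u} {v} e = trans (adj-sym G v u) e

Separates : {V : Set} → Graph V → Subset V → V → V → Set
Separates G K u v = u ∉ K × v ∉ K × ¬ WalkIn G (∁ K) u v

module _ {V : Set} {G : Graph V} where

  walk-start : ∀ {S u v} → WalkIn G S u v → u ∈ S
  walk-start (here u∈S)     = u∈S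
  walk-start (step u∈S _ _) = u∈S

  walk-end : ∀ {S u v} → WalkIn G S u v → v ∈ S
  walk-end (here v∈S)   = v∈S
  walk-end (step _ _ w) = walk-end w

  walk-edge : ∀ {S u v} → u ∈ S → v ∈ S → Edge G u v → WalkIn G S u v
  walk-edge u∈S v∈S e = step u∈S e (here v∈S)

  walk-trans : ∀ {S u v w} → WalkIn G S u v → WalkIn G S v w → WalkIn G S u w
  walk-trans (here _)       q = q
  walk-trans (step u∈S e p) q = step u∈S e (walk-trans p q)

  walk-sym : ∀ {S u v} → WalkIn G S u v → WalkIn G S v u
  walk-sym (here u∈S)     = here u∈S
  walk-sym (step u∈S e p) = walk-trans (walk-sym p) (walk-edge (walk-start p) u∈S (edge-sym G e))

  walk-mono : ∀ {S T u v} → S ⊆ T → WalkIn G S u v → WalkIn G T u v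
  walk-mono S⊆T (here u∈S)     = here (S⊆T _ u∈S)
  walk-mono S⊆T (step u∈S e p) = step (S⊆T _ u∈S) e (walk-mono S⊆T p)

  hub-connects : ∀ {S t u v} → (∀ w → w ∈ S → ¬ ¬ WalkIn G S w t) →
                 u ∈ S → v ∈ S → ¬ ¬ WalkIn G S u v
  hub-connects reach u∈S v∈S ¬uv =
    reach _ u∈S λ ut → reach _ v∈S λ vt → ¬uv (walk-trans ut (walk-sym vt))

  path-avoiding⇒walk : ∀ {S T R u v} → PathAvoidingInterior G S T u v →
                       S ∖ T ⊆ R → u ∈ R → v ∈ R → WalkIn G R u v
  path-avoiding⇒walk (_ , _ , inj₁ refl) _ u∈R _ = here u∈R
  path-avoiding⇒walk (_ , _ , inj₂ (inj₁ e)) _ u∈R v∈R = walk-edge u∈R v∈R e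
  path-avoiding⇒walk (_ , _ , inj₂ (inj₂ (_ , _ , e , p , e′))) inner⊆R u∈R v∈R =
    step u∈R e (walk-trans inner (walk-edge (walk-end inner) v∈R e′))
    where inner = walk-mono inner⊆R p

  ∪-clique : ∀ {S T} → IsClique G S → IsClique G T →
             (∀ x y → x ∈ S → y ∈ T → Edge G x y) → IsClique G (S ∪ T)
  ∪-clique {S} {T} S-clique T-clique S-T-complete x y x∈ y∈ x≢y
    with ∈-∪⁻ S T x∈ | ∈-∪⁻ S T y∈
  ... | inj₁ x∈S | inj₁ y∈S = S-clique x y x∈S y∈S x≢y
  ... | inj₁ x∈S | inj₂ y∈T = S-T-complete x y x∈S y∈T
  ... | inj₂ x∈T | inj₁ y∈S = edge-sym G (S-T-complete y x y∈S x∈T)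
  ... | inj₂ x∈T | inj₂ y∈T = T-clique x y x∈T y∈T x≢y

  singleton-clique : ∀ {S} → IsSingleton S → IsClique G S
  singleton-clique (_ , _ , only) x y x∈S y∈S x≢y =
    ⊥-elim (x≢y (trans (only x x∈S) (sym (only y y∈S))))

module _ {V : Set} {G : Graph V} (J : TwoJoinData G) where

  port : Bool → Bool → Subset V
  port true  = A J
  port false = B J

  X-not : ∀ i v → X J (not i) v ≡ not (X J i v)
  X-not true  v = refl
  X-not false v = sym (not-involutive (side J v))

  ∉-side⇒∈-other-side : ∀ i {v} → v ∉ X J i → v ∈ X J (not i)
  ∉-side⇒∈-other-side i {v} v∉Xᵢ = trans (X-not i v) (∉⇒∈∁ v∉Xᵢ)

  ∈-other-side⇒∉-side : ∀ i {v} → v ∈ X J (not i) → v ∉ X J i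
  ∈-other-side⇒∉-side i {v} v∈X = ∈∁⇒∉ (trans (sym (X-not i v)) v∈X)

  sides-distinct : ∀ i {x y} → x ∈ X J i → y ∈ X J (not i) → x ≢ y
  sides-distinct i x∈Xᵢ y∈X refl = not-¬ x∈Xᵢ (∈-other-side⇒∉-side i y∈X)

  WithinPorts : Bool → Subset V → Set
  WithinPorts q K = ∀ j {z} → z ∈ K → z ∈ X J j → z ∈ port q j

record ConsistentPorts {V : Set} {G : Graph V} (J : TwoJoinData G) : Set where
  field
    port⊆side : ∀ q i → port J q i ⊆ X J i
    port-nonempty : ∀ q i → Nonempty (port J q i)
    ports-disjoint : ∀ q i {v} → v ∈ port J q i → v ∈ port J (not q) i → ⊥
    ports-complete : ∀ q i {u v} → u ∈ port J q i → v ∈ port J q (not i) → Edge G u v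
    cross-edge-in-ports : ∀ i {u v} → u ∈ X J i → v ∈ X J (not i) → Edge G u v →
                          ∃[ q ] (u ∈ port J q i × v ∈ port J q (not i))
    port-clique-or-singleton : ∀ q i → IsClique G (port J q (not i)) ⊎ IsSingleton (port J q i)
    side-connected : ∀ i → ConnectedIn G (X J i)
    path-to-other-port : ∀ q i v → v ∈ X J i →
      ∃[ b ] (b ∈ port J (not q) i × PathAvoidingInterior G (X J i) (port J q i) v b)

  port-unique : ∀ q q′ i {v} → v ∈ port J q i → v ∈ port J q′ i → q ≡ q′
  port-unique q q′ i {v} v∈ v∈′ with q ≟ q′
  ... | yes q≡q′ = q≡q′
  ... | no  q≢q′ = ⊥-elim (ports-disjoint q i v∈ (subst (λ r → v ∈ port J r i) (¬-not (q≢q′ ∘ sym)) v∈′))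

module _ {V : Set} {G : Graph V} {J : TwoJoinData G} where

  clique-condition-at : ∀ {S} → CliqueCondition J S → ∀ i → IsClique G (S (not i)) ⊎ IsSingleton (S i)
  clique-condition-at (inj₁ (_ , S₂-clique)) true  = inj₁ S₂-clique
  clique-condition-at (inj₁ (S₁-clique , _)) false = inj₁ S₁-clique
  clique-condition-at (inj₂ (inj₁ (S₁-single , _))) true  = inj₂ S₁-single
  clique-condition-at (inj₂ (inj₁ (S₁-single , _))) false = inj₁ (singleton-clique {G = G} S₁-single)
  clique-condition-at (inj₂ (inj₂ (S₂-single , _))) true  = inj₁ (singleton-clique {G = G} S₂-single)
  clique-condition-at (inj₂ (inj₂ (S₂-single , _))) false = inj₂ S₂-single

  consistent-ports : IsConsistent J → ConsistentPorts J
  consistent-ports ((A⊆X , B⊆X , A∩B=∅ , A≠∅ , B≠∅ , A-complete , B-complete , cross-only , _) ,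
                    _ , _ , _ , A-condition , B-condition , connected , to-B , to-A) = record
    { port⊆side = λ { true → A⊆X ; false → B⊆X }
    ; port-nonempty = λ { true → A≠∅ ; false → B≠∅ }
    ; ports-disjoint = λ { true i {v} a b → A∩B=∅ i v a b ; false i {v} b a → A∩B=∅ i v a b }
    ; ports-complete = complete
    ; cross-edge-in-ports = cross
    ; port-clique-or-singleton = λ { true → clique-condition-at A-condition
                                   ; false → clique-condition-at B-condition }
    ; side-connected = connected
    ; path-to-other-port = λ { true → to-B ; false → to-A }
    }
    where
    complete : ∀ q i {u v} → u ∈ port J q i → v ∈ port J q (not i) → Edge G u v
    complete true  true  u∈ v∈ = A-complete _ _ u∈ v∈
    complete true  false u∈ v∈ = edge-sym G (A-complete _ _ v∈ u∈)
    complete false true  u∈ v∈ = B-complete _ _ u∈ v∈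
    complete false false u∈ v∈ = edge-sym G (B-complete _ _ v∈ u∈)

    cross : ∀ i {u v} → u ∈ X J i → v ∈ X J (not i) → Edge G u v →
            ∃[ q ] (u ∈ port J q i × v ∈ port J q (not i))
    cross true  u∈ v∈ e with cross-only _ _ u∈ v∈ e
    ... | inj₁ (u∈A , v∈A) = true  , u∈A , v∈A
    ... | inj₂ (u∈B , v∈B) = false , u∈B , v∈B
    cross false u∈ v∈ e with cross-only _ _ v∈ u∈ (edge-sym G e)
    ... | inj₁ (v∈A , u∈A) = true  , u∈A , v∈A
    ... | inj₂ (v∈B , u∈B) = false , u∈B , v∈B

end : Bool → Extra
end true  = ea
end false = eb

only-end : Bool → Subset Extra
only-end true  ea = true
only-end false eb = true
only-end _     _  = false

only-end-unique : ∀ q {y} → y ∈ only-end q → y ≡ end q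
only-end-unique true  {ea} _ = refl
only-end-unique false {eb} _ = refl

only-end-self : ∀ q → end q ∈ only-end q
only-end-self true  = refl
only-end-self false = refl

only-end-other : ∀ q → end (not q) ∉ only-end q
only-end-other true  = refl
only-end-other false = refl

new-vertex-cases : ∀ q y → y ≡ end q ⊎ y ≡ end (not q) ⊎ y ≡ ec
new-vertex-cases true  ea = inj₁ refl
new-vertex-cases true  eb = inj₂ (inj₁ refl)
new-vertex-cases false ea = inj₂ (inj₁ refl)
new-vertex-cases false eb = inj₁ refl
new-vertex-cases _     ec = inj₂ (inj₂ refl)

module _ {V : Set} {G : Graph V} {J : TwoJoinData G} (C : ConsistentPorts J) where
  open ConsistentPorts C

  other-port⇒∉-port : ∀ q j {v} → v ∈ port J (not q) j → v ∉ port J q j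
  other-port⇒∉-port q j {v} v∈ with ∈-or-∉ (port J q j v)
  ... | inj₁ v∈′ = ⊥-elim (ports-disjoint q j v∈′ v∈)
  ... | inj₂ v∉  = v∉

  walk-leaving-side : ∀ i {S u v} → WalkIn G S u v → u ∈ X J i → v ∉ X J i →
    ∃[ x ] ∃[ q ] ∃[ y ] (x ∈ port J q i × y ∈ port J q (not i) × y ∈ S × WalkIn G (S ∩ X J i) u x)
  walk-leaving-side i (here _) u∈X v∉X = ⊥-elim (not-¬ u∈X v∉X)
  walk-leaving-side i {S} (step {w = w} u∈S e rest) u∈X v∉X with ∈-or-∉ (X J i w)
  ... | inj₁ w∈X with walk-leaving-side i rest w∈X v∉X
  ...   | x , q , y , x∈ , y∈ , y∈S , inside =
    x , q , y , x∈ , y∈ , y∈S , step (∈-∩⁺ S (X J i) u∈S u∈X) e inside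
  walk-leaving-side i {S} {u} (step {w = w} u∈S e rest) u∈X v∉X | inj₂ w∉X
    with cross-edge-in-ports i u∈X (∉-side⇒∈-other-side J i w∉X) e
  ... | q , u∈ , w∈ = u , q , w , u∈ , w∈ , walk-start rest , here (∈-∩⁺ S (X J i) u∈S u∈X)

  crossing-clique-in-ports : ∀ {K x₁ x₂} → IsClique G K →
    x₁ ∈ K → x₁ ∈ X J true → x₂ ∈ K → x₂ ∈ X J false → ∃[ q ] WithinPorts J q K
  crossing-clique-in-ports {K} {x₁} {x₂} K-clique x₁∈K x₁∈X x₂∈K x₂∈X
    with cross-edge-in-ports true x₁∈X x₂∈X (K-clique _ _ x₁∈K x₂∈K (sides-distinct J true x₁∈X x₂∈X))
  ... | q , x₁∈ , x₂∈ = q , in-port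
    where
    in-port : WithinPorts J q K
    in-port true {z} z∈K z∈X
      with cross-edge-in-ports true z∈X x₂∈X (K-clique _ _ z∈K x₂∈K (sides-distinct J true z∈X x₂∈X))
    ... | q′ , z∈ , x₂∈′ = subst (λ r → z ∈ port J r true) (port-unique q′ q false x₂∈′ x₂∈) z∈
    in-port false {z} z∈K z∈X
      with cross-edge-in-ports true x₁∈X z∈X (K-clique _ _ x₁∈K z∈K (sides-distinct J true x₁∈X z∈X))
    ... | q′ , x₁∈′ , z∈ = subst (λ r → z ∈ port J r false) (port-unique q′ q true x₁∈′ x₁∈) z∈

  other-port-free : ∀ q {K} → WithinPorts J q K → ∀ j {z} → z ∈ port J (not q) j → z ∈ ∁ K
  other-port-free q {K} K⊆ports j {z} z∈ with ∈-or-∉ (K z)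
  ... | inj₁ z∈K = ⊥-elim (ports-disjoint q j (K⊆ports j z∈K (port⊆side (not q) j z z∈)) z∈)
  ... | inj₂ z∉K = ∉⇒∈∁ z∉K

  port-complement-free : ∀ q {K} → WithinPorts J q K → ∀ j → X J j ∖ port J q j ⊆ ∁ K
  port-complement-free q {K} K⊆ports j z z∈ with ∈-or-∉ (K z) | ∈-∩⁻ (X J j) (∁ (port J q j)) z∈
  ... | inj₁ z∈K | z∈X , z∉P = ⊥-elim (not-¬ (K⊆ports j z∈K z∈X) (∈∁⇒∉ z∉P))
  ... | inj₂ z∉K | _ = ∉⇒∈∁ z∉K

  module _ (i : Bool) where

    private
      H : Graph (BlockV J i)
      H = Block J i

    ι : (x : V) → x ∈ X J i → BlockV J i
    ι x p = inj₁ (x , p)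

    ι-irrelevant : ∀ (T : Subset (BlockV J i)) {x} (p p′ : x ∈ X J i) → T (ι x p) ≡ T (ι x p′)
    ι-irrelevant T p p′ rewrite uip p p′ = refl

    attached : ∀ q {x} (p : x ∈ X J i) → x ∈ port J q i → Edge H (ι x p) (inj₂ (end q))
    attached true  _ x∈ = x∈
    attached false _ x∈ = x∈

    attached⁻¹ : ∀ q {x} (p : x ∈ X J i) → Edge H (ι x p) (inj₂ (end q)) → x ∈ port J q i
    attached⁻¹ true  _ e = e
    attached⁻¹ false _ e = e

    end-middle : ∀ q → Edge H (inj₂ (end q)) (inj₂ ec)
    end-middle true  = refl
    end-middle false = refl

    walk-to-end : ∀ q {K z} (pz : z ∈ X J i) → z ∈ port J q i → ι z pz ∉ K → inj₂ (end q) ∉ K →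
                  WalkIn H (∁ K) (ι z pz) (inj₂ (end q))
    walk-to-end q pz z∈ z∉K e∉K = walk-edge (∉⇒∈∁ z∉K) (∉⇒∈∁ e∉K) (attached q pz z∈)

    restrict-at : Subset (BlockV J i) → (x : V) (b : Bool) → X J i x ≡ b → Bool
    restrict-at T x true  p = T (ι x p)
    restrict-at T x false _ = false

    restrict : Subset (BlockV J i) → Subset V
    restrict T x = restrict-at T x (X J i x) refl

    restrict-cases : ∀ T x →
      (Σ (x ∈ X J i) λ p → restrict T x ≡ T (ι x p)) ⊎ (x ∉ X J i × x ∉ restrict T)
    restrict-cases T x = at (X J i x) refl
      where
      at : ∀ b (q : X J i x ≡ b) →
           (Σ (x ∈ X J i) λ p → restrict-at T x b q ≡ T (ι x p)) ⊎
           (x ∉ X J i × restrict-at T x b q ≡ false)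
      at true  q = inj₁ (q , refl)
      at false q = inj₂ (q , refl)

    restrict-ι : ∀ T {x} (p : x ∈ X J i) → restrict T x ≡ T (ι x p)
    restrict-ι T {x} p with restrict-cases T x
    ... | inj₁ (p′ , eq)  = trans eq (ι-irrelevant T p′ p)
    ... | inj₂ (x∉X , _) = ⊥-elim (not-¬ p x∉X)

    restrict-outside : ∀ T {x} → x ∉ X J i → x ∉ restrict T
    restrict-outside T {x} x∉X with restrict-cases T x
    ... | inj₁ (p , _)    = ⊥-elim (not-¬ p x∉X)
    ... | inj₂ (_ , x∉T) = x∉T

    restrict-∈ : ∀ T {x} → x ∈ restrict T → Σ (x ∈ X J i) λ p → ι x p ∈ T
    restrict-∈ T {x} x∈ with restrict-cases T x
    ... | inj₁ (p , eq)   = p , trans (sym eq) x∈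
    ... | inj₂ (_ , x∉T) = ⊥-elim (not-¬ x∈ x∉T)

    restrict-clique : ∀ {K} → IsClique H K → IsClique G (restrict K)
    restrict-clique {K} K-clique x y x∈ y∈ x≢y with restrict-∈ K x∈ | restrict-∈ K y∈
    ... | _ , ιx∈K | _ , ιy∈K = K-clique _ _ ιx∈K ιy∈K λ { refl → x≢y refl }

    lift : Subset V → Subset Extra → Subset (BlockV J i)
    lift K E (inj₁ (x , _)) = K x
    lift K E (inj₂ y)       = E y

    lift-clique : ∀ {K E} → IsClique G K →
      (∀ x (p : x ∈ X J i) y → x ∈ K → y ∈ E → Edge H (ι x p) (inj₂ y)) →
      (∀ {y y′} → y ∈ E → y′ ∈ E → y ≡ y′) → IsClique H (lift K E)
    lift-clique K-clique _ _ (inj₁ (x , p)) (inj₁ (y , p′)) x∈ y∈ x≢y =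
      K-clique x y x∈ y∈ λ { refl → x≢y (cong (ι x) (uip p p′)) }
    lift-clique _ K~E _ (inj₁ (x , p)) (inj₂ y) x∈ y∈ _ = K~E x p y x∈ y∈
    lift-clique _ K~E _ (inj₂ y) (inj₁ (x , p)) y∈ x∈ _ = edge-sym H {ι x p} {inj₂ y} (K~E x p y x∈ y∈)
    lift-clique _ _ E-unique (inj₂ y) (inj₂ y′) y∈ y′∈ y≢y′ = ⊥-elim (y≢y′ (cong inj₂ (E-unique y∈ y′∈)))

    walk-into-block : ∀ {S T} → S ⊆ X J i → (∀ x p → x ∈ S → ι x p ∈ T) →
      ∀ {u v} → WalkIn G S u v → (pu : u ∈ X J i) (pv : v ∈ X J i) → WalkIn H T (ι u pu) (ι v pv)
    walk-into-block _ ι-S⊆T (here u∈S) pu pv rewrite uip pu pv = here (ι-S⊆T _ pv u∈S)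
    walk-into-block S⊆X ι-S⊆T (step u∈S e rest) pu pv =
      step (ι-S⊆T _ pu u∈S) e (walk-into-block S⊆X ι-S⊆T rest (S⊆X _ (walk-start rest)) pv)

    walk-to-extra⇒walk-to-port : ∀ {S T} → (∀ x p → ι x p ∈ T → x ∈ S) →
      ∀ {u} {pu : u ∈ X J i} {y} → WalkIn H T (ι u pu) (inj₂ y) →
      ∃[ z ] ∃[ q ] (z ∈ port J q i × inj₂ (end q) ∈ T × WalkIn G S u z)
    walk-to-extra⇒walk-to-port T⊆S {pu = pu} (step {w = inj₁ _} u∈T e rest)
      with walk-to-extra⇒walk-to-port T⊆S rest
    ... | z , q , z∈ , end∈T , inside = z , q , z∈ , end∈T , step (T⊆S _ pu u∈T) e inside
    walk-to-extra⇒walk-to-port T⊆S {u} {pu} (step {w = inj₂ ea} u∈T e rest) =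
      u , true , e , walk-start rest , here (T⊆S _ pu u∈T)
    walk-to-extra⇒walk-to-port T⊆S {u} {pu} (step {w = inj₂ eb} u∈T e rest) =
      u , false , e , walk-start rest , here (T⊆S _ pu u∈T)
    walk-to-extra⇒walk-to-port _ (step {w = inj₂ ec} _ () _)

    side-free-clique-connects : ∀ {K} → IsClique H K → (∀ x p → ι x p ∉ K) →
                                ∀ {u v} → u ∉ K → v ∉ K → WalkIn H (∁ K) u v
    side-free-clique-connects {K} K-clique side-free u∉K v∉K =
      walk-trans (to-hub _ u∉K) (walk-sym (to-hub _ v∉K))
      where
      a₀ : V
      a₀ = proj₁ (port-nonempty true i)
      a₀∈X : a₀ ∈ X J i
      a₀∈X = port⊆side true i a₀ (proj₂ (port-nonempty true i))
      side-to-hub : ∀ x p → WalkIn H (∁ K) (ι x p) (ι a₀ a₀∈X)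
      side-to-hub x p = walk-into-block (λ _ z∈X → z∈X) (λ z pz _ → ∉⇒∈∁ (side-free z pz))
                                        (side-connected i x a₀ p a₀∈X) p a₀∈X
      end-to-hub : ∀ q → inj₂ (end q) ∉ K → WalkIn H (∁ K) (inj₂ (end q)) (ι a₀ a₀∈X)
      end-to-hub q e∉K with port-nonempty q i
      ... | x , x∈ = walk-trans (walk-sym (walk-to-end q px x∈ (side-free x px) e∉K)) (side-to-hub x px)
        where
        px : x ∈ X J i
        px = port⊆side q i x x∈
      to-hub : ∀ w → w ∉ K → WalkIn H (∁ K) w (ι a₀ a₀∈X)
      to-hub (inj₁ (x , p)) _ = side-to-hub x p
      to-hub (inj₂ ea) a∉K = end-to-hub true a∉K
      to-hub (inj₂ eb) b∉K = end-to-hub false b∉K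
      to-hub (inj₂ ec) c∉K with ∈-or-∉ (K (inj₂ ea)) | ∈-or-∉ (K (inj₂ eb))
      ... | inj₂ a∉K | _ = step (∉⇒∈∁ c∉K) refl (end-to-hub true a∉K)
      ... | _ | inj₂ b∉K = step (∉⇒∈∁ c∉K) refl (end-to-hub false b∉K)
      ... | inj₁ a∈K | inj₁ b∈K with K-clique _ _ a∈K b∈K (λ ())
      ...   | ()

    block-separation⇒cutset : ∀ {K Q t x y₀} → IsClique G (restrict K ∪ Q) → Q ⊆ X J (not i) →
      (∀ q z (pz : z ∈ X J i) {y} → z ∈ port J q i → y ∈ port J q (not i) → ι z pz ∉ K → y ∉ Q →
         WalkIn H (∁ K) (ι z pz) t) →
      (px : x ∈ X J i) → ι x px ∉ K → ¬ WalkIn H (∁ K) (ι x px) t →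
      y₀ ∈ X J (not i) → y₀ ∉ Q → HasCliqueCutset G
    block-separation⇒cutset {K} {Q} {t} {x} {y₀} Kg-clique Q⊆X exit px ιx∉K ¬x→t y₀∈X y₀∉Q =
      restrict K ∪ Q , Kg-clique , x , y₀ ,
      ∉-∪⁺ (restrict K) Q (trans (restrict-ι K px) ιx∉K) x∉Q ,
      ∉-∪⁺ (restrict K) Q (restrict-outside K (∈-other-side⇒∉-side J i y₀∈X)) y₀∉Q ,
      no-crossing
      where
      x∉Q : x ∉ Q
      x∉Q with ∈-or-∉ (Q x)
      ... | inj₁ x∈Q = ⊥-elim (not-¬ px (∈-other-side⇒∉-side J i (Q⊆X x x∈Q)))
      ... | inj₂ x∉Q = x∉Q
      lowered : ∀ z (pz : z ∈ X J i) → z ∈ ∁ (restrict K ∪ Q) → ι z pz ∈ ∁ K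
      lowered z pz z∈ = ∉⇒∈∁ (trans (sym (restrict-ι K pz)) (∉-∪⁻ˡ (restrict K) Q (∈∁⇒∉ z∈)))
      no-crossing : ¬ WalkIn G (∁ (restrict K ∪ Q)) x y₀
      no-crossing walk with walk-leaving-side i walk px (∈-other-side⇒∉-side J i y₀∈X)
      ... | z , q , y , z∈ , y∈ , y∈∁ , inside =
        ¬x→t (walk-trans to-z (exit q z pz z∈ y∈ (∈∁⇒∉ (walk-end to-z)) y∉Q))
        where
        pz : z ∈ X J i
        pz = port⊆side q i z z∈
        y∉Q : y ∉ Q
        y∉Q = ∉-∪⁻ʳ (restrict K) Q (∈∁⇒∉ y∈∁)
        to-z : WalkIn H (∁ K) (ι x px) (ι z pz)
        to-z = walk-into-block (λ w w∈ → proj₂ (∈-∩⁻ (∁ (restrict K ∪ Q)) (X J i) w∈))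
                               (λ w pw w∈ → lowered w pw (proj₁ (∈-∩⁻ (∁ (restrict K ∪ Q)) (X J i) w∈)))
                               inside px pz

    far-vertex : ∀ p → ∃[ y ] (y ∈ X J (not i) × y ∉ port J p (not i))
    far-vertex p with port-nonempty (not p) (not i)
    ... | y , y∈ = y , port⊆side (not p) (not i) y y∈ , other-port⇒∉-port p (not i) y∈

    path-free-block-cutset⇒¬¬cutset : ∀ {K u v} → IsClique H K →
      inj₂ ea ∉ K → inj₂ eb ∉ K → inj₂ ec ∉ K → Separates H K u v → ¬ ¬ HasCliqueCutset G
    path-free-block-cutset⇒¬¬cutset {K} K-clique a∉K b∉K c∉K (u∉K , v∉K , ¬uv) noG =
      hub-connects reach (∉⇒∈∁ u∉K) (∉⇒∈∁ v∉K) ¬uv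
      where
      end∉K : ∀ q → inj₂ (end q) ∉ K
      end∉K true  = a∉K
      end∉K false = b∉K
      via-end : ∀ q → WalkIn H (∁ K) (inj₂ (end q)) (inj₂ ec)
      via-end q = walk-edge (∉⇒∈∁ (end∉K q)) (∉⇒∈∁ c∉K) (end-middle q)
      reach : ∀ w → w ∈ ∁ K → ¬ ¬ WalkIn H (∁ K) w (inj₂ ec)
      reach (inj₁ (x , px)) x∈ ¬x→c with far-vertex true
      ... | y₀ , y₀∈X , _ = noG (block-separation⇒cutset {Q = ∅}
        (∪-clique {G = G} (restrict-clique K-clique) (λ _ _ ()) (λ _ _ _ ())) (λ _ ())
        (λ q z pz z∈ _ z∉K _ → walk-trans (walk-to-end q pz z∈ z∉K (end∉K q)) (via-end q))
        px (∈∁⇒∉ x∈) ¬x→c y₀∈X refl)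
      reach (inj₂ ea) _  ¬w = ¬w (via-end true)
      reach (inj₂ eb) _  ¬w = ¬w (via-end false)
      reach (inj₂ ec) c∈ ¬w = ¬w (here c∈)

    clique-with-end-in-port : ∀ p {K z} (pz : z ∈ X J i) → IsClique H K → inj₂ (end p) ∈ K → ι z pz ∈ K →
                              z ∈ port J p i
    clique-with-end-in-port p pz K-clique e∈K z∈K = attached⁻¹ p pz (K-clique _ _ z∈K e∈K λ ())

    walk-to-other-end : ∀ p {K} → inj₂ (end (not p)) ∉ K → ∀ q z (pz : z ∈ X J i) →
      z ∈ port J q i → ι z pz ∉ K → q ≢ p → WalkIn H (∁ K) (ι z pz) (inj₂ (end (not p)))
    walk-to-other-end p e′∉K q z pz z∈ z∉K q≢p =
      walk-to-end (not p) pz (subst (λ r → z ∈ port J r i) (¬-not q≢p) z∈) z∉K e′∉K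

    end-block-cutset-clique-port⇒cutset : ∀ p {K x} → IsClique H K →
      inj₂ (end p) ∈ K → inj₂ (end (not p)) ∉ K → IsClique G (port J p (not i)) →
      (px : x ∈ X J i) → ι x px ∉ K →
      ¬ WalkIn H (∁ K) (ι x px) (inj₂ (end (not p))) → HasCliqueCutset G
    end-block-cutset-clique-port⇒cutset p {K} K-clique e∈K e′∉K P-clique px x∉K ¬x→t
      with far-vertex p
    ... | y₀ , y₀∈X , y₀∉P = block-separation⇒cutset {Q = port J p (not i)}
      (∪-clique {G = G} (restrict-clique K-clique) P-clique K~P) (port⊆side p (not i))
      (λ q z pz z∈ y∈ z∉K y∉P → walk-to-other-end p e′∉K q z pz z∈ z∉K λ { refl → not-¬ y∈ y∉P })
      px x∉K ¬x→t y₀∈X y₀∉P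
      where
      K~P : ∀ z y → z ∈ restrict K → y ∈ port J p (not i) → Edge G z y
      K~P z y z∈ y∈ with restrict-∈ K z∈
      ... | pz , z∈K = ports-complete p i (clique-with-end-in-port p pz K-clique e∈K z∈K) y∈

    end-block-cutset-singleton-port⇒¬¬cutset : ∀ p {K u v x} → IsClique H K →
      inj₂ (end p) ∈ K → inj₂ (end (not p)) ∉ K → IsSingleton (port J p i) → Separates H K u v →
      (px : x ∈ X J i) → ι x px ∉ K →
      ¬ WalkIn H (∁ K) (ι x px) (inj₂ (end (not p))) → ¬ ¬ HasCliqueCutset G
    end-block-cutset-singleton-port⇒¬¬cutset p {K} K-clique e∈K e′∉K (a₀ , a₀∈ , only-a₀) (u∉K , v∉K , ¬uv)
                                             px x∉K ¬x→t noG
      with ∈-or-∉ (K (ι a₀ (port⊆side p i a₀ a₀∈)))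
    ... | inj₂ a₀∉K = ¬uv (side-free-clique-connects K-clique side-free u∉K v∉K)
      where
      pa₀ : a₀ ∈ X J i
      pa₀ = port⊆side p i a₀ a₀∈
      side-free : ∀ z pz → ι z pz ∉ K
      side-free z pz with ∈-or-∉ (K (ι z pz))
      ... | inj₂ z∉K = z∉K
      ... | inj₁ z∈K with only-a₀ z (clique-with-end-in-port p pz K-clique e∈K z∈K)
      ...   | refl = ⊥-elim (not-¬ (trans (ι-irrelevant K pa₀ pz) z∈K) a₀∉K)
    ... | inj₁ a₀∈K with far-vertex p
    ...   | y₀ , y₀∈X , _ = noG (block-separation⇒cutset {Q = ∅}
      (∪-clique {G = G} (restrict-clique K-clique) (λ _ _ ()) (λ _ _ _ ())) (λ _ ())
      (λ q z pz z∈ _ z∉K _ → walk-to-other-end p e′∉K q z pz z∈ z∉K λ { refl → not-a₀ z pz z∈ z∉K })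
      px x∉K ¬x→t y₀∈X refl)
      where
      pa₀ : a₀ ∈ X J i
      pa₀ = port⊆side p i a₀ a₀∈
      not-a₀ : ∀ z pz → z ∈ port J p i → ι z pz ∉ K → ⊥
      not-a₀ z pz z∈ z∉K with only-a₀ z z∈
      ... | refl = not-¬ (trans (ι-irrelevant K pz pa₀) a₀∈K) z∉K

    end-block-cutset⇒¬¬cutset : ∀ p {K u v} → IsClique H K →
      inj₂ (end p) ∈ K → inj₂ (end (not p)) ∉ K → Separates H K u v → ¬ ¬ HasCliqueCutset G
    end-block-cutset⇒¬¬cutset p {K} K-clique e∈K e′∉K sep@(u∉K , v∉K , ¬uv) noG =
      hub-connects reach (∉⇒∈∁ u∉K) (∉⇒∈∁ v∉K) ¬uv
      where
      reach : ∀ w → w ∈ ∁ K → ¬ ¬ WalkIn H (∁ K) w (inj₂ (end (not p)))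
      reach (inj₁ (x , px)) x∈ ¬x→t with port-clique-or-singleton p i
      ... | inj₁ P-clique =
        noG (end-block-cutset-clique-port⇒cutset p K-clique e∈K e′∉K P-clique px (∈∁⇒∉ x∈) ¬x→t)
      ... | inj₂ single =
        end-block-cutset-singleton-port⇒¬¬cutset p K-clique e∈K e′∉K single sep px (∈∁⇒∉ x∈) ¬x→t noG
      reach (inj₂ y) y∈ ¬y→t with new-vertex-cases p y
      ... | inj₁ refl = not-¬ e∈K (∈∁⇒∉ y∈)
      ... | inj₂ (inj₁ refl) = ¬y→t (here y∈)
      ... | inj₂ (inj₂ refl) =
        ¬y→t (walk-edge y∈ (∉⇒∈∁ e′∉K) (edge-sym H {inj₂ (end (not p))} (end-middle (not p))))

    block-cutset⇒¬¬cutset : HasCliqueCutset H → ¬ ¬ HasCliqueCutset G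
    block-cutset⇒¬¬cutset (K , K-clique , _ , _ , u∉K , v∉K , ¬uv)
      with ∈-or-∉ (K (inj₂ ec)) | ∈-or-∉ (K (inj₂ ea)) | ∈-or-∉ (K (inj₂ eb))
    ... | inj₁ c∈K | _ | _ = λ _ → ¬uv (side-free-clique-connects K-clique middle-isolates u∉K v∉K)
      where
      middle-isolates : ∀ x p → ι x p ∉ K
      middle-isolates x p with ∈-or-∉ (K (ι x p))
      ... | inj₂ x∉K = x∉K
      ... | inj₁ x∈K with K-clique _ _ x∈K c∈K (λ ())
      ...   | ()
    ... | inj₂ c∉K | inj₁ a∈K | inj₁ b∈K with K-clique _ _ a∈K b∈K (λ ())
    ...   | ()
    block-cutset⇒¬¬cutset (K , K-clique , _ , _ , sep) | inj₂ c∉K | inj₂ a∉K | inj₂ b∉K =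
      path-free-block-cutset⇒¬¬cutset K-clique a∉K b∉K c∉K sep
    block-cutset⇒¬¬cutset (K , K-clique , _ , _ , sep) | inj₂ _ | inj₁ a∈K | inj₂ b∉K =
      end-block-cutset⇒¬¬cutset true K-clique a∈K b∉K sep
    block-cutset⇒¬¬cutset (K , K-clique , _ , _ , sep) | inj₂ _ | inj₂ a∉K | inj₁ b∈K =
      end-block-cutset⇒¬¬cutset false K-clique b∈K a∉K sep

    lift-separates : ∀ {K E z₀ w} (pw : w ∈ X J i) {y} → w ∉ K → y ∉ E →
      (∀ q {x} → x ∈ port J q i → end q ∉ E → x ∉ K → WalkIn G (∁ K) x z₀) →
      ¬ WalkIn G (∁ K) w z₀ → Separates H (lift K E) (ι w pw) (inj₂ y)
    lift-separates {K} {E} {w = w} pw {y} w∉K y∉E exit ¬w→z₀ = w∉K , y∉E , escape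
      where
      escape : ¬ WalkIn H (∁ (lift K E)) (ι w pw) (inj₂ y)
      escape walk with walk-to-extra⇒walk-to-port (λ _ _ x∈ → x∈) walk
      ... | x , q , x∈ , end∈ , to-x =
        ¬w→z₀ (walk-trans to-x (exit q x∈ (∈∁⇒∉ end∈) (∈∁⇒∉ (walk-end to-x))))

    side-avoiding-cutset⇒¬¬block-cutset : ∀ {K u v} → IsClique G K →
      ¬ (∃[ x ] (x ∈ K × x ∈ X J (not i))) → Separates G K u v → ¬ ¬ HasCliqueCutset H
    side-avoiding-cutset⇒¬¬block-cutset {K} K-clique K-avoids (u∉K , v∉K , ¬uv) noH =
      hub-connects reach (∉⇒∈∁ u∉K) (∉⇒∈∁ v∉K) ¬uv
      where
      b₀ : V
      b₀ = proj₁ (port-nonempty false (not i))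
      b₀∈X : b₀ ∈ X J (not i)
      b₀∈X = port⊆side false (not i) b₀ (proj₂ (port-nonempty false (not i)))
      other-side-free : X J (not i) ⊆ ∁ K
      other-side-free z z∈X with ∈-or-∉ (K z)
      ... | inj₁ z∈K = ⊥-elim (K-avoids (z , z∈K , z∈X))
      ... | inj₂ z∉K = ∉⇒∈∁ z∉K
      through-other-side : ∀ {z} → z ∈ X J (not i) → WalkIn G (∁ K) z b₀
      through-other-side z∈X = walk-mono other-side-free (side-connected (not i) _ b₀ z∈X b₀∈X)
      exit : ∀ q {x} → x ∈ port J q i → end q ∉ ∅ → x ∉ K → WalkIn G (∁ K) x b₀
      exit q x∈ _ x∉K with port-nonempty q (not i)
      ... | y , y∈ =
        step (∉⇒∈∁ x∉K) (ports-complete q i x∈ y∈) (through-other-side (port⊆side q (not i) y y∈))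
      reach : ∀ w → w ∈ ∁ K → ¬ ¬ WalkIn G (∁ K) w b₀
      reach w w∈ ¬w→b₀ with ∈-or-∉ (X J i w)
      ... | inj₂ w∉X = ¬w→b₀ (through-other-side (∉-side⇒∈-other-side J i w∉X))
      ... | inj₁ w∈X = noH (lift K ∅ , lift-clique K-clique (λ _ _ _ _ ()) (λ ()) ,
                            ι w w∈X , inj₂ ec , lift-separates w∈X (∈∁⇒∉ w∈) refl exit ¬w→b₀)

    port-cutset⇒¬¬block-cutset : ∀ q {K u v} → IsClique G K → WithinPorts J q K →
      Separates G K u v → ¬ ¬ HasCliqueCutset H
    port-cutset⇒¬¬block-cutset q {K} K-clique K⊆ports (u∉K , v∉K , ¬uv) noH =
      hub-connects reach (∉⇒∈∁ u∉K) (∉⇒∈∁ v∉K) ¬uv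
      where
      z₀ : V
      z₀ = proj₁ (port-nonempty (not q) i)
      z₀∈ : z₀ ∈ port J (not q) i
      z₀∈ = proj₂ (port-nonempty (not q) i)
      from-partner : ∀ {y} → y ∈ port J (not q) (not i) → WalkIn G (∁ K) y z₀
      from-partner y∈ = walk-edge (other-port-free q K⊆ports (not i) y∈) (other-port-free q K⊆ports i z₀∈)
                                  (edge-sym G (ports-complete (not q) i z₀∈ y∈))
      exit : ∀ q′ {x} → x ∈ port J q′ i → end q′ ∉ only-end q → x ∉ K → WalkIn G (∁ K) x z₀
      exit q′ x∈ end∉ x∉K with q′ ≟ q
      ... | yes refl = ⊥-elim (not-¬ (only-end-self q) end∉)
      ... | no q′≢q with ¬-not q′≢q | port-nonempty (not q) (not i)
      ...   | refl | y , y∈ = step (∉⇒∈∁ x∉K) (ports-complete (not q) i x∈ y∈) (from-partner y∈)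
      reach : ∀ w → w ∈ ∁ K → ¬ ¬ WalkIn G (∁ K) w z₀
      reach w w∈ ¬w→z₀ with ∈-or-∉ (X J i w)
      ... | inj₂ w∉X with path-to-other-port q (not i) w (∉-side⇒∈-other-side J i w∉X)
      ...   | b , b∈ , path = ¬w→z₀ (walk-trans to-b (from-partner b∈))
        where
        to-b : WalkIn G (∁ K) w b
        to-b = path-avoiding⇒walk path (port-complement-free q K⊆ports (not i)) w∈
                                  (other-port-free q K⊆ports (not i) b∈)
      reach w w∈ ¬w→z₀ | inj₁ w∈X =
        noH (lift K (only-end q) , lift-clique K-clique K~end only-end-unique′ ,
             ι w w∈X , inj₂ (end (not q)) , lift-separates w∈X (∈∁⇒∉ w∈) (only-end-other q) exit ¬w→z₀)
        where
        only-end-unique′ : ∀ {y y′} → y ∈ only-end q → y′ ∈ only-end q → y ≡ y′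
        only-end-unique′ y∈ y′∈ = trans (only-end-unique q y∈) (sym (only-end-unique q y′∈))
        K~end : ∀ x (p : x ∈ X J i) y → x ∈ K → y ∈ only-end q → Edge H (ι x p) (inj₂ y)
        K~end x p y x∈K y∈ with only-end-unique q y∈
        ... | refl = attached q p (K⊆ports i x∈K p)

  no-block-cutset⇒no-cutset : ¬ HasCliqueCutset (Block J true) → ¬ HasCliqueCutset (Block J false) →
                              ¬ HasCliqueCutset G
  no-block-cutset⇒no-cutset no₁ no₂ (K , K-clique , _ , _ , sep) =
    ¬¬-excluded-middle λ where
      (no K∌X₁) → side-avoiding-cutset⇒¬¬block-cutset false K-clique K∌X₁ sep no₂
      (yes (x₁ , x₁∈K , x₁∈X)) → ¬¬-excluded-middle λ where
        (no K∌X₂) → side-avoiding-cutset⇒¬¬block-cutset true K-clique K∌X₂ sep no₁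
        (yes (x₂ , x₂∈K , x₂∈X)) →
          let q , K⊆ports = crossing-clique-in-ports K-clique x₁∈K x₁∈X x₂∈K x₂∈X
          in port-cutset⇒¬¬block-cutset true q K-clique K⊆ports sep no₁

lemma6p3 : (n : ℕ) (G : Graph (Fin n)) (J : TwoJoinData G) →
           Is2Join J → IsConsistent J →
           (¬ HasCliqueCutset G) ⇔
             (¬ HasCliqueCutset (Block J true) × ¬ HasCliqueCutset (Block J false))
lemma6p3 _ G J _ consistent = mk⇔
  (λ noG → (λ cut → block-cutset⇒¬¬cutset C true cut noG) ,
           (λ cut → block-cutset⇒¬¬cutset C false cut noG))
  (λ (no₁ , no₂) → no-block-cutset⇒no-cutset C no₁ no₂)
  where
  C : ConsistentPorts J
  C = consistent-ports consistent
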